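{- Every finite simple graph $G$ such that both $G$ and $\overline{G}$ are distance-hereditary is distance-hereditary and AT-free.
   Context: A graph is distance-hereditary if it contains no induced hole (cycle of length at least $5$), house ($4$-cycle plus a vertex adjacent to exactly two adjacent vertices of the cycle), domino (two $4$-cycles sharing an edge), or gem ($P_4$ plus a vertex adjacent to all its vertices). An asteroidal triple is a set of three vertices such that each pair of them is joined by a path avoiding the closed neighbourhood of the third. A graph is AT-free if it has no asteroidal triple. -}

module Defs where

open import Data.Nat using (ℕ; zero; suc; _≤_; _≡ᵇ_)
open import Data.Fin using (Fin; toℕ) renaming (_≟_ to _≟ᶠ_)
open import Data.Fin.Patterns
open import Data.Bool using (Bool; true; false; not; _∧_; _∨_)
open import Data.Product using (Σ; ∃; _×_; _,_)
open import Data.List using (List; []; _∷_)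
open import Relation.Nullary using (¬_)
open import Relation.Nullary.Decidable using (⌊_⌋)
open import Relation.Binary.PropositionalEquality using (_≡_; _≢_)
open import Function.Definitions using (Injective)

record Graph : Set where
  field
    n      : ℕ
    adj    : Fin n → Fin n → Bool
    sym    : ∀ i j → adj i j ≡ adj j i
    irrefl : ∀ i → adj i i ≡ false
open Graph public

complAdj : (G : Graph) → Fin (n G) → Fin (n G) → Bool
complAdj G i j = not (adj G i j) ∧ not ⌊ i ≟ᶠ j ⌋

open import Relation.Binary.PropositionalEquality using (refl; cong₂; cong)
open import Relation.Nullary using (yes; no)
import Relation.Binary.PropositionalEquality as Eq

private
  eqb-sym : ∀ {m} (i j : Fin m) → ⌊ i ≟ᶠ j ⌋ ≡ ⌊ j ≟ᶠ i ⌋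
  eqb-sym i j with i ≟ᶠ j | j ≟ᶠ i
  ... | yes _ | yes _ = refl
  ... | no _  | no _  = refl
  ... | yes p | no q  = Data.Empty.⊥-elim (q (Eq.sym p))
    where import Data.Empty
  ... | no p  | yes q = Data.Empty.⊥-elim (p (Eq.sym q))
    where import Data.Empty

  eqb-refl : ∀ {m} (i : Fin m) → ⌊ i ≟ᶠ i ⌋ ≡ true
  eqb-refl i with i ≟ᶠ i
  ... | yes _ = refl
  ... | no q  = Data.Empty.⊥-elim (q refl)
    where import Data.Empty

complement : Graph → Graph
complement G = record
  { n      = n G
  ; adj    = complAdj G
  ; sym    = λ i j → cong₂ (λ a b → not a ∧ not b) (Graph.sym G i j) (eqb-sym i j)
  ; irrefl = λ i → Eq.trans (cong₂ (λ a b → not a ∧ not b) (irrefl G i) (eqb-refl i)) refl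
  }

InducedCopy : (k : ℕ) → (Fin k → Fin k → Bool) → Graph → Set
InducedCopy k H G =
  Σ (Fin k → Fin (n G)) λ f → Injective _≡_ _≡_ f × (∀ i j → adj G (f i) (f j) ≡ H i j)

cycleAdj : (k : ℕ) → Fin k → Fin k → Bool
cycleAdj k i j =
  (suc (toℕ i) ≡ᵇ toℕ j) ∨ (suc (toℕ j) ≡ᵇ toℕ i)
  ∨ ((toℕ i ≡ᵇ 0) ∧ (suc (toℕ j) ≡ᵇ k))
  ∨ ((toℕ j ≡ᵇ 0) ∧ (suc (toℕ i) ≡ᵇ k))

edgeIn : ∀ {k} → List (Fin k × Fin k) → Fin k → Fin k → Bool
edgeIn [] i j = false
edgeIn ((a , b) ∷ es) i j =
  (⌊ i ≟ᶠ a ⌋ ∧ ⌊ j ≟ᶠ b ⌋) ∨ (⌊ i ≟ᶠ b ⌋ ∧ ⌊ j ≟ᶠ a ⌋) ∨ edgeIn es i j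

-- House: 4-cycle 0-1-2-3-0 plus vertex 4 adjacent to exactly 0 and 1.
houseAdj : Fin 5 → Fin 5 → Bool
houseAdj = edgeIn ((0F , 1F) ∷ (1F , 2F) ∷ (2F , 3F) ∷ (3F , 0F) ∷ (4F , 0F) ∷ (4F , 1F) ∷ [])

-- Domino: two 4-cycles 0-1-4-5-0 and 1-2-3-4-1 sharing the edge 1-4.
dominoAdj : Fin 6 → Fin 6 → Bool
dominoAdj = edgeIn ((0F , 1F) ∷ (1F , 2F) ∷ (2F , 3F) ∷ (3F , 4F) ∷ (4F , 5F) ∷ (5F , 0F) ∷ (1F , 4F) ∷ [])

-- Gem: P4 0-1-2-3 plus vertex 4 adjacent to all of 0,1,2,3.
gemAdj : Fin 5 → Fin 5 → Bool
gemAdj = edgeIn ((0F , 1F) ∷ (1F , 2F) ∷ (2F , 3F) ∷ (4F , 0F) ∷ (4F , 1F) ∷ (4F , 2F) ∷ (4F , 3F) ∷ [])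

HasHole : Graph → Set
HasHole G = Σ ℕ λ k → (5 ≤ k) × InducedCopy k (cycleAdj k) G

DistanceHereditary : Graph → Set
DistanceHereditary G =
  ¬ HasHole G × ¬ InducedCopy 5 houseAdj G × ¬ InducedCopy 6 dominoAdj G × ¬ InducedCopy 5 gemAdj G

OutsideN : (G : Graph) → Fin (n G) → Fin (n G) → Set
OutsideN G z v = (v ≢ z) × (adj G z v ≡ false)

data AvoidingPath (G : Graph) (z : Fin (n G)) : Fin (n G) → Fin (n G) → Set where
  single : ∀ {u} → OutsideN G z u → AvoidingPath G z u u
  step   : ∀ {u w v} → OutsideN G z u → adj G u w ≡ true →
           AvoidingPath G z w v → AvoidingPath G z u v

AsteroidalTriple : (G : Graph) → Fin (n G) → Fin (n G) → Fin (n G) → Set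
AsteroidalTriple G x y z =
  (x ≢ y) × (y ≢ z) × (x ≢ z) ×
  AvoidingPath G z x y × AvoidingPath G x y z × AvoidingPath G y x z

ATFree : Graph → Set
ATFree G = ∀ x y z → ¬ AsteroidalTriple G x y z

-- An asteroidal triple x, y, z is an independent set. Inside G − N[z] an induced
-- P₄ would form, together with z, the complement of a gem; so two vertices joined by
-- a path avoiding N[z] are equal, adjacent, or have a common neighbour outside N[z].
-- This gives common neighbours a of x, y outside N[z], b of y, z outside N[x] and
-- c of x, z outside N[y]. Then x a y b z c is a 6-cycle whose only possible chords
-- are ab, bc and ca, and each of the eight choices of chords leaves an induced gem,
-- house, C₅ or C₆ in G.

module Submission where

open import Defs renaming (sym to adj-sym)
open import Data.Bool using (Bool; true; false; not; _∧_)
open import Data.Bool.Properties using (∧-identityʳ; not-involutive) renaming (_≟_ to _≟ᵇ_)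
open import Data.Fin using (Fin; _≟_)
open import Data.Fin.Patterns
open import Data.Fin.Properties using (all?; any?)
open import Data.Nat using (ℕ)
open import Data.Nat.Properties using (≤-refl; n≤1+n)
open import Data.Product using (_×_; _,_; proj₂; ∃-syntax)
open import Data.Empty using (⊥; ⊥-elim)
open import Data.Vec.Functional using ([]; _∷_)
open import Function using (_∘_; id)
open import Function.Definitions using (Injective)
open import Relation.Nullary using (¬_; Dec; yes; no; ¬?; contradiction)
open import Relation.Nullary.Decidable using (True; toWitness; from-yes; _×-dec_; _→-dec_)
open import Relation.Binary.PropositionalEquality
  using (_≡_; _≢_; refl; sym; trans; cong; module ≡-Reasoning)

Pattern : ℕ → Set
Pattern k = Fin k → Fin k → Bool

-- A record, so that G, H and f can be recovered from the type by unification.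
record Induces (G : Graph) {k : ℕ} (H : Pattern k) (f : Fin k → Fin (n G)) : Set where
  constructor induces
  field adjacent : ∀ i j → i ≢ j → adj G (f i) (f j) ≡ H i j

Loopless : ∀ {k} → Pattern k → Set
Loopless H = ∀ i → H i i ≡ false

TwinFree : ∀ {k} → Pattern k → Set
TwinFree H = ∀ i j → i ≢ j → ∃[ m ] m ≢ i × m ≢ j × H i m ≢ H j m

Embeds : ∀ {m k} → Pattern m → Pattern k → (Fin m → Fin k) → Set
Embeds H′ H g = (∀ i j → g i ≡ g j → i ≡ j) × (∀ i j → H (g i) (g j) ≡ H′ i j)

pairwise? : ∀ {k} {P : Fin k → Fin k → Set} → (∀ i j → Dec (P i j)) → Dec (∀ i j → P i j)
pairwise? P? = all? λ i → all? (P? i)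

loopless? : ∀ {k} (H : Pattern k) → Dec (Loopless H)
loopless? H = all? λ i → H i i ≟ᵇ false

twinFree? : ∀ {k} (H : Pattern k) → Dec (TwinFree H)
twinFree? H = pairwise? λ i j → ¬? (i ≟ j) →-dec
  any? λ m → ¬? (m ≟ i) ×-dec ¬? (m ≟ j) ×-dec ¬? (H i m ≟ᵇ H j m)

embeds? : ∀ {m k} (H′ : Pattern m) (H : Pattern k) (g : Fin m → Fin k) → Dec (Embeds H′ H g)
embeds? H′ H g = pairwise? (λ i j → g i ≟ g j →-dec i ≟ j)
           ×-dec pairwise? (λ i j → H (g i) (g j) ≟ᵇ H′ i j)

module _ {G : Graph} {k : ℕ} {H : Pattern k} {f : Fin k → Fin (n G)} where
  open ≡-Reasoning

  induces⇒injective : TwinFree H → Induces G H f → Injective _≡_ _≡_ f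
  induces⇒injective twinFree (induces induced) {i} {j} fi≡fj with i ≟ j
  ... | yes i≡j = i≡j
  ... | no i≢j with twinFree i j i≢j
  ...   | m , m≢i , m≢j , rows-differ = contradiction (begin
          H i m             ≡⟨ sym (induced i m (m≢i ∘ sym)) ⟩
          adj G (f i) (f m) ≡⟨ cong (λ v → adj G v (f m)) fi≡fj ⟩
          adj G (f j) (f m) ≡⟨ induced j m (m≢j ∘ sym) ⟩
          H j m             ∎) rows-differ

  induces⇒inducedCopy : Loopless H → TwinFree H → Induces G H f → InducedCopy k H G
  induces⇒inducedCopy loopless twinFree induced = f , induces⇒injective twinFree induced , adjacency
    where
    adjacency : ∀ i j → adj G (f i) (f j) ≡ H i j
    adjacency i j with i ≟ j
    ... | yes refl = begin
          adj G (f i) (f i) ≡⟨ irrefl G (f i) ⟩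
          false             ≡⟨ sym (loopless i) ⟩
          H i i             ∎
    ... | no i≢j = Induces.adjacent induced i j i≢j

  induces-complement : Injective _≡_ _≡_ f →
    Induces G (λ i j → not (H i j)) f → Induces (complement G) H f
  induces-complement f-injective (induces induced) = induces adjacent
    where
    adjacent : ∀ i j → i ≢ j → complAdj G (f i) (f j) ≡ H i j
    adjacent i j i≢j with f i ≟ f j
    ... | yes fi≡fj = contradiction (f-injective fi≡fj) i≢j
    ... | no _ = begin
          not (adj G (f i) (f j)) ∧ true ≡⟨ ∧-identityʳ _ ⟩
          not (adj G (f i) (f j))        ≡⟨ cong not (induced i j i≢j) ⟩
          not (not (H i j))              ≡⟨ not-involutive (H i j) ⟩
          H i j                          ∎

  induces-∘ : ∀ {m} {H′ : Pattern m} {g : Fin m → Fin k} →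
    Induces G H f → Embeds H′ H g → Induces G H′ (f ∘ g)
  induces-∘ {H′ = H′} {g} (induces induced) (g-injective , g-embeds) =
    induces λ i j i≢j → begin
      adj G (f (g i)) (f (g j)) ≡⟨ induced (g i) (g j) (i≢j ∘ g-injective i j) ⟩
      H (g i) (g j)             ≡⟨ g-embeds i j ⟩
      H′ i j                    ∎

inducedCopy : ∀ {G k} (H : Pattern k) {f : Fin k → Fin (n G)} →
  {_ : True (loopless? H)} {_ : True (twinFree? H)} → Induces G H f → InducedCopy k H G
inducedCopy H {_} {loopless} {twinFree} =
  induces⇒inducedCopy (toWitness loopless) (toWitness twinFree)

restrict : ∀ {G m k} {H′ : Pattern m} {H : Pattern k} {f : Fin k → Fin (n G)} →
  Induces G H f → (g : Fin m → Fin k) → {_ : True (embeds? H′ H g)} → Induces G H′ (f ∘ g)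
restrict induced g {embeds} = induces-∘ induced (toWitness embeds)

-- The 6-cycle x a y b z c on the vertices 0, …, 5, with the chords ab, bc, ca
-- present according to p, q, r.
hexagonAdj : Bool → Bool → Bool → Pattern 6
hexagonAdj p q r 1F 3F = p
hexagonAdj p q r 3F 1F = p
hexagonAdj p q r 3F 5F = q
hexagonAdj p q r 5F 3F = q
hexagonAdj p q r 5F 1F = r
hexagonAdj p q r 1F 5F = r
hexagonAdj p q r i  j  = cycleAdj 6 i j

hexagon-notDH : ∀ {G} → DistanceHereditary G →
  ∀ p q r {f : Fin 6 → Fin (n G)} → ¬ Induces G (hexagonAdj p q r) f
hexagon-notDH (noHole , noHouse , _ , noGem) = λ where
  true  true  true  hex →
    noGem (inducedCopy gemAdj (restrict hex (0F ∷ 1F ∷ 3F ∷ 4F ∷ 5F ∷ [])))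
  true  true  false hex →
    noHouse (inducedCopy houseAdj (restrict hex (1F ∷ 3F ∷ 5F ∷ 0F ∷ 2F ∷ [])))
  false true  true  hex →
    noHouse (inducedCopy houseAdj (restrict hex (3F ∷ 5F ∷ 1F ∷ 2F ∷ 4F ∷ [])))
  true  false true  hex →
    noHouse (inducedCopy houseAdj (restrict hex (5F ∷ 1F ∷ 3F ∷ 4F ∷ 0F ∷ [])))
  true  false false hex →
    noHole (5 , ≤-refl , inducedCopy (cycleAdj 5) (restrict hex (0F ∷ 1F ∷ 3F ∷ 4F ∷ 5F ∷ [])))
  false true  false hex →
    noHole (5 , ≤-refl , inducedCopy (cycleAdj 5) (restrict hex (2F ∷ 3F ∷ 5F ∷ 0F ∷ 1F ∷ [])))
  false false true  hex →
    noHole (5 , ≤-refl , inducedCopy (cycleAdj 5) (restrict hex (4F ∷ 5F ∷ 1F ∷ 2F ∷ 3F ∷ [])))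
  false false false hex →
    noHole (6 , n≤1+n 5 , inducedCopy (cycleAdj 6) (restrict hex id))

adj-swap : ∀ G {u v β} → adj G u v ≡ β → adj G v u ≡ β
adj-swap G {u} {v} uv = trans (adj-sym G v u) uv

hexagon-induces : ∀ {G x y z a b c} →
  adj G x y ≡ false → adj G y z ≡ false → adj G x z ≡ false →
  adj G x a ≡ true → adj G a y ≡ true → adj G z a ≡ false →
  adj G y b ≡ true → adj G b z ≡ true → adj G x b ≡ false →
  adj G x c ≡ true → adj G c z ≡ true → adj G y c ≡ false →
  Induces G (hexagonAdj (adj G a b) (adj G b c) (adj G c a)) (x ∷ a ∷ y ∷ b ∷ z ∷ c ∷ [])
hexagon-induces {G} {x} {y} {z} {a} {b} {c}
  x≁y y≁z x≁z x~a a~y z≁a y~b b~z x≁b x~c c~z y≁c = induces adjacent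
  where
  hexagon : Fin 6 → Fin (n G)
  hexagon = x ∷ a ∷ y ∷ b ∷ z ∷ c ∷ []
  swap : ∀ {s t β} → adj G s t ≡ β → adj G t s ≡ β
  swap = adj-swap G
  adjacent : ∀ i j → i ≢ j →
    adj G (hexagon i) (hexagon j) ≡ hexagonAdj (adj G a b) (adj G b c) (adj G c a) i j
  adjacent 0F 0F 0≢0 = contradiction refl 0≢0
  adjacent 0F 1F _ = x~a
  adjacent 0F 2F _ = x≁y
  adjacent 0F 3F _ = x≁b
  adjacent 0F 4F _ = x≁z
  adjacent 0F 5F _ = x~c
  adjacent 1F 0F _ = swap x~a
  adjacent 1F 1F 1≢1 = contradiction refl 1≢1
  adjacent 1F 2F _ = a~y
  adjacent 1F 3F _ = refl
  adjacent 1F 4F _ = swap z≁a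
  adjacent 1F 5F _ = adj-sym G a c
  adjacent 2F 0F _ = swap x≁y
  adjacent 2F 1F _ = swap a~y
  adjacent 2F 2F 2≢2 = contradiction refl 2≢2
  adjacent 2F 3F _ = y~b
  adjacent 2F 4F _ = y≁z
  adjacent 2F 5F _ = y≁c
  adjacent 3F 0F _ = swap x≁b
  adjacent 3F 1F _ = adj-sym G b a
  adjacent 3F 2F _ = swap y~b
  adjacent 3F 3F 3≢3 = contradiction refl 3≢3
  adjacent 3F 4F _ = b~z
  adjacent 3F 5F _ = refl
  adjacent 4F 0F _ = swap x≁z
  adjacent 4F 1F _ = z≁a
  adjacent 4F 2F _ = swap y≁z
  adjacent 4F 3F _ = swap b~z
  adjacent 4F 4F 4≢4 = contradiction refl 4≢4
  adjacent 4F 5F _ = swap c~z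
  adjacent 5F 0F _ = swap x~c
  adjacent 5F 1F _ = refl
  adjacent 5F 2F _ = swap y≁c
  adjacent 5F 3F _ = adj-sym G c b
  adjacent 5F 4F _ = c~z
  adjacent 5F 5F 5≢5 = contradiction refl 5≢5

noCoGem : ∀ {G} → ¬ InducedCopy 5 gemAdj (complement G) → ∀ {z u w a v} →
  adj G z u ≡ false → adj G z w ≡ false → adj G z a ≡ false → adj G z v ≡ false →
  adj G u w ≡ true → adj G w a ≡ true → adj G a v ≡ true →
  adj G u a ≡ false → adj G w v ≡ false → adj G u v ≡ false → ⊥
noCoGem {G} noGemᶜ {z} {u} {w} {a} {v} z≁u z≁w z≁a z≁v u~w w~a a~v u≁a w≁v u≁v =
  noGemᶜ (inducedCopy gemAdj (induces-complement coGem-injective coGem-induces))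
  where
  -- The complement of the gem is the path 2 – 0 – 3 – 1 plus the isolated vertex 4.
  coGem : Fin 5 → Fin (n G)
  coGem = w ∷ v ∷ u ∷ a ∷ z ∷ []
  swap : ∀ {s t β} → adj G s t ≡ β → adj G t s ≡ β
  swap = adj-swap G
  adjacent : ∀ i j → i ≢ j → adj G (coGem i) (coGem j) ≡ not (gemAdj i j)
  adjacent 0F 0F 0≢0 = contradiction refl 0≢0
  adjacent 0F 1F _ = w≁v
  adjacent 0F 2F _ = swap u~w
  adjacent 0F 3F _ = w~a
  adjacent 0F 4F _ = swap z≁w
  adjacent 1F 0F _ = swap w≁v
  adjacent 1F 1F 1≢1 = contradiction refl 1≢1
  adjacent 1F 2F _ = swap u≁v
  adjacent 1F 3F _ = swap a~v
  adjacent 1F 4F _ = swap z≁v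
  adjacent 2F 0F _ = u~w
  adjacent 2F 1F _ = u≁v
  adjacent 2F 2F 2≢2 = contradiction refl 2≢2
  adjacent 2F 3F _ = u≁a
  adjacent 2F 4F _ = swap z≁u
  adjacent 3F 0F _ = swap w~a
  adjacent 3F 1F _ = a~v
  adjacent 3F 2F _ = swap u≁a
  adjacent 3F 3F 3≢3 = contradiction refl 3≢3
  adjacent 3F 4F _ = swap z≁a
  adjacent 4F 0F _ = z≁w
  adjacent 4F 1F _ = z≁v
  adjacent 4F 2F _ = z≁u
  adjacent 4F 3F _ = z≁a
  adjacent 4F 4F 4≢4 = contradiction refl 4≢4
  coGem-induces : Induces G (λ i j → not (gemAdj i j)) coGem
  coGem-induces = induces adjacent
  coGem-injective : Injective _≡_ _≡_ coGem
  coGem-injective = induces⇒injective (from-yes (twinFree? λ i j → not (gemAdj i j))) coGem-induces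

source-outside : ∀ {G z u v} → AvoidingPath G z u v → OutsideN G z u
source-outside (single u∉N[z])   = u∉N[z]
source-outside (step u∉N[z] _ _) = u∉N[z]

target-outside : ∀ {G z u v} → AvoidingPath G z u v → OutsideN G z v
target-outside (single v∉N[z]) = v∉N[z]
target-outside (step _ _ w⇝v)  = target-outside w⇝v

CommonNeighbourOutside : (G : Graph) (z u v : Fin (n G)) → Set
CommonNeighbourOutside G z u v = ∃[ a ] OutsideN G z a × adj G u a ≡ true × adj G a v ≡ true

data ShortAvoidingPath (G : Graph) (z u v : Fin (n G)) : Set where
  length0 : u ≡ v → ShortAvoidingPath G z u v
  length1 : adj G u v ≡ true → ShortAvoidingPath G z u v
  length2 : CommonNeighbourOutside G z u v → ShortAvoidingPath G z u v

shorten : ∀ {G z u v} → ¬ InducedCopy 5 gemAdj (complement G) →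
  AvoidingPath G z u v → ShortAvoidingPath G z u v
shorten noGemᶜ (single _) = length0 refl
shorten {G} {u = u} {v = v} noGemᶜ (step {w = w} (_ , z≁u) u~w w⇝v) with shorten noGemᶜ w⇝v
... | length0 refl = length1 u~w
... | length1 w~v  = length2 (w , source-outside w⇝v , u~w , w~v)
... | length2 (a , a∉N[z] , w~a , a~v)
    with adj G u a in ua | adj G w v in wv | adj G u v in uv
...   | true  | _     | _     = length2 (a , a∉N[z] , ua , a~v)
...   | false | true  | _     = length2 (w , source-outside w⇝v , u~w , wv)
...   | false | false | true  = length1 uv
...   | false | false | false = ⊥-elim (noCoGem {G} noGemᶜ
    z≁u (proj₂ (source-outside w⇝v)) (proj₂ a∉N[z]) (proj₂ (target-outside w⇝v))
    u~w w~a a~v ua wv uv)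

commonNeighbourOutside : ∀ {G z u v} → ¬ InducedCopy 5 gemAdj (complement G) →
  AvoidingPath G z u v → u ≢ v → adj G u v ≡ false → CommonNeighbourOutside G z u v
commonNeighbourOutside noGemᶜ u⇝v u≢v u≁v with shorten noGemᶜ u⇝v
... | length0 u≡v = contradiction u≡v u≢v
... | length1 u~v with () ← trans (sym u~v) u≁v
... | length2 a   = a

atFree : ∀ {G} → DistanceHereditary G → ¬ InducedCopy 5 gemAdj (complement G) → ATFree G
atFree {G} dh noGemᶜ x y z (x≢y , y≢z , x≢z , x⇝y , y⇝z , x⇝z) =
  let x≁y = proj₂ (source-outside y⇝z)
      y≁z = proj₂ (target-outside x⇝z)
      x≁z = proj₂ (target-outside y⇝z)
      (a , (_ , z≁a) , x~a , a~y) = commonNeighbourOutside noGemᶜ x⇝y x≢y x≁y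
      (b , (_ , x≁b) , y~b , b~z) = commonNeighbourOutside noGemᶜ y⇝z y≢z y≁z
      (c , (_ , y≁c) , x~c , c~z) = commonNeighbourOutside noGemᶜ x⇝z x≢z x≁z
  in hexagon-notDH dh _ _ _
       (hexagon-induces {G} x≁y y≁z x≁z x~a a~y z≁a y~b b~z x≁b x~c c~z y≁c)

mainTheorem9 : (G : Graph) → DistanceHereditary G → DistanceHereditary (complement G) →
    DistanceHereditary G × ATFree G
mainTheorem9 G dh (_ , _ , _ , noGemᶜ) = dh , atFree dh noGemᶜ
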